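{- Let $p$ be a prime and $n \geq 1$ an integer. Let $L_n$ denote the linear subspace of $\mathbb{F}_p[x_1,\ldots,x_n]$ spanned by the monomials $\prod_{i=1}^n x_i^{\alpha_i}$ with $0 \leq \alpha_i < p$ for all $i$, and for an integer $d$ let $L_{n,d}$ denote the subspace of $L_n$ spanned by those monomials of (total) degree at most $d$. Let $\{(a_i,b_i)\}_{i=1}^m$ be a perfectly matched sequence in $\mathbb{F}_p^n$, with target set $T = \{a_i+b_i \mid i=1,\ldots,m\}$. Then $|T| \leq 3 \dim L_{n,d}$, where $d = \lfloor \frac13 (p-1) n \rfloor$.
   Context: A perfectly matched sequence in an abelian group $H$ is a sequence of ordered pairs $\{(a_i,b_i)\}_{i=1}^m$ in $H^2$ such that the equation $a_i+b_i = a_j+b_k$ (with $i,j,k \in \{1,\ldots,m\}$) has no solutions with $j \neq k$. Its target set is $T = \{a_i+b_i \mid i = 1,\ldots,m\}$. -}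

module Defs where

open import Data.Nat using (ℕ; zero; suc; _+_; _*_; _∸_; _≤_; _≤?_; NonZero)
open import Data.Nat.DivMod using (_mod_; _/_)
open import Data.Fin using (Fin; toℕ)
open import Data.Fin.Properties using () renaming (_≟_ to _≟ᶠ_)
open import Data.Vec using (Vec; []; _∷_; zipWith; toList)
open import Data.Vec.Properties using (≡-dec)
open import Data.List using (List; []; _∷_; map; concatMap; length; filter; deduplicate; allFin)
open import Data.Nat.ListAction using (sum)
open import Data.Product using (_×_; proj₁; proj₂)
open import Relation.Binary.PropositionalEquality using (_≡_)

_+ₚ_ : ∀ {p} .{{_ : NonZero p}} → Fin p → Fin p → Fin p
_+ₚ_ {p} a b = (toℕ a + toℕ b) mod p

_⊕_ : ∀ {p n} .{{_ : NonZero p}} → Vec (Fin p) n → Vec (Fin p) n → Vec (Fin p) n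
_⊕_ = zipWith _+ₚ_

PerfectlyMatched : ∀ {p n m} .{{_ : NonZero p}} → (Fin m → Vec (Fin p) n × Vec (Fin p) n) → Set
PerfectlyMatched {m = m} ab =
  (i j k : Fin m) → proj₁ (ab i) ⊕ proj₂ (ab i) ≡ proj₁ (ab j) ⊕ proj₂ (ab k) → j ≡ k

targetSize : ∀ {p n m} .{{_ : NonZero p}} → (Fin m → Vec (Fin p) n × Vec (Fin p) n) → ℕ
targetSize {m = m} ab =
  length (deduplicate (≡-dec _≟ᶠ_) (map (λ i → proj₁ (ab i) ⊕ proj₂ (ab i)) (allFin m)))

allExponents : ∀ p n → List (Vec (Fin p) n)
allExponents p zero = [] ∷ []
allExponents p (suc n) = concatMap (λ a → map (a ∷_) (allExponents p n)) (allFin p)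

degree : ∀ {p n} → Vec (Fin p) n → ℕ
degree α = sum (map toℕ (toList α))

-- dim L_{n,d}: L_{n,d} is spanned by the (linearly independent) monomials x^α
-- with 0 ≤ α_i < p and total degree ≤ d, so its dimension is their number.
dimL : ℕ → ℕ → ℕ → ℕ
dimL p n d = length (filter (λ α → degree α ≤? d) (allExponents p n))

-- The slice-rank argument, with 𝔽ₚ modelled by ℤ modulo p.
-- Index the distinct targets by u, choosing (a_u, b_u) with a_u + b_u = c_u; perfect matching means
-- a_u + b_v = c_w only when u = v = w. Hence, with q(x) = (x − 1)(x − 2)⋯(x − (p − 1)), which is
-- nonzero mod p exactly at x ≡ 0, the tensor D(u,v,w) = ∏ᵢ q(a_{u,i} + b_{v,i} − c_{w,i}) is diagonal
-- with nonzero diagonal. Expanding D into monomials x^α y^β z^γ with αᵢ + βᵢ + γᵢ ≤ p − 1, one of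
-- α, β, γ always has degree ≤ d = ⌊(p − 1)n/3⌋; the set E of reduced exponents of degree ≤ d has
-- dim L_{n,d} elements.
-- Take h orthogonal (in u) to the |E| low-degree monomials in a_u, and then w orthogonal (in v) to the
-- |E| low-degree monomials in b_v and to the |E| vectors collecting the γ-low terms; their supports have
-- size at least s − |E| and s − 2|E|. Contracting D with h and w then gives zero, although it also equals
-- w_z h_z D(z,z,z); so the supports of h and w are disjoint and 2s − 3|E| ≤ s.
module Submission where

open import Defs
open import Data.Nat using (ℕ; _*_; _∸_; _≤_; _/_; NonZero)
open import Data.Nat.Primality using (Prime)
open import Data.Fin using (Fin)
open import Data.Vec using (Vec)
open import Data.Product using (_×_)

open import Data.Empty using (⊥; ⊥-elim)
open import Data.Fin using (zero; suc; toℕ; punchIn)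
open import Data.Fin.Properties using (toℕ-injective; toℕ<n; toℕ-fromℕ<; punchInᵢ≢i)
  renaming (_≟_ to _≟ᶠ_)
open import Data.Integer using (ℤ; +_; 0ℤ; 1ℤ; ∣_∣)
  renaming (_+_ to _+ᶻ_; _*_ to _*ᶻ_; -_ to -ᶻ_; _-_ to _-ᶻ_; _^_ to _^ᶻ_)
import Data.Integer.Properties as ℤ
open import Data.Integer.DivMod using (_%ℕ_; _/ℕ_; a≡a%ℕn+[a/ℕn]*n; n%ℕd<d)
open import Data.Integer.Divisibility.Signed
  using (_∣_; divides; ∣ᵤ⇒∣; ∣⇒∣ᵤ; ∣m⇒∣-m; ∣m∣n⇒∣m+n; ∣m∣n⇒∣m-n; ∣n⇒∣m*n; ∣m⇒∣m*n)
open import Data.Integer.Tactic.RingSolver using (solve-∀)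
open import Data.List
  using (List; []; _∷_; _++_; length; map; concatMap; filter; tabulate; lookup; allFin; deduplicate)
open import Data.List.Properties using (length-map; length-++; length-tabulate; length-removeAt′)
open import Data.List.Membership.Propositional using (_∈_)
open import Data.List.Membership.Propositional.Properties
  using (∈-concatMap⁺; ∈-map⁺; ∈-map⁻; ∈-allFin; ∈-filter⁺; ∈-tabulate⁺; ∈-lookup; ∈-deduplicate⁻)
open import Data.List.Relation.Unary.All as All using (All; []; _∷_; all?)
open import Data.List.Relation.Unary.All.Properties
  using (map⁺; map⁻; concat⁺; ++⁻ˡ; ++⁻ʳ; ─⁻; ¬All⇒Any¬)
open import Data.List.Relation.Unary.AllPairs using ([]; _∷_)
open import Data.List.Relation.Unary.Any as Any using (Any; here; _─_)
open import Data.List.Relation.Unary.Any.Properties using (lookup-result; lookup-index)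
open import Data.List.Relation.Unary.Unique.Propositional using (Unique)
open import Data.List.Relation.Unary.Unique.DecPropositional.Properties using (deduplicate-!)
open import Data.Nat using (zero; suc; _+_; _<_; z≤n; s≤s; _≤?_)
open import Data.Nat.DivMod using (_mod_; m<n⇒m%n≡m; m%n<n; m*n/n≡m; /-monoˡ-≤)
open import Data.Nat.Divisibility using (∣1⇒≡1; n∣m⇒m%n≡0) renaming (_∣_ to _∣ℕ_; _∣?_ to _∣ℕ?_)
open import Data.Nat.Primality using (euclidsLemma; ¬prime[1])
import Data.Nat.Properties as ℕ
open import Data.Nat.Tactic.RingSolver using () renaming (solve-∀ to solve-∀ᴺ)
open import Data.Product using (∃-syntax; _,_; proj₁; proj₂)
open import Data.Sum as Sum using (_⊎_; inj₁; inj₂; [_,_]′)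
open import Data.Unit using (⊤; tt)
open import Data.Vec using ([]; _∷_)
import Data.Vec as Vec
import Data.Vec.Properties as Vecₚ
open import Data.Vec.Functional using (Vector; tail; removeAt) renaming (_∷_ to _∷ᶠ_)
open import Data.Vec.Relation.Unary.All as VAll using ([]; _∷_) renaming (All to VAll)
open import Function using (_∘_)
open import Relation.Binary.PropositionalEquality
  using (_≡_; _≢_; _≗_; refl; sym; trans; cong; cong₂; subst; subst₂; module ≡-Reasoning)
open import Relation.Nullary using (Dec; yes; no; ¬_; contradiction)
import Relation.Nullary.Decidable as Dec

open import Algebra.Properties.Semiring.Sum ℤ.+-*-semiring
  using (sum; sum-syntax; sum-cong-≗; sum-remove; sum-replicate-zero; ∑-distrib-+; *-distribˡ-sum)

∑ₗ : {A : Set} → List A → (A → ℤ) → ℤ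
∑ₗ []       f = 0ℤ
∑ₗ (x ∷ xs) f = f x +ᶻ ∑ₗ xs f

infixl 10 ∑ₗ
syntax ∑ₗ L (λ t → e) = ∑[ t ∈ L ] e

module _ {A : Set} where

  ∑ₗ-cong : ∀ (L : List A) {f g : A → ℤ} → f ≗ g → ∑ₗ L f ≡ ∑ₗ L g
  ∑ₗ-cong []      f≗g = refl
  ∑ₗ-cong (x ∷ L) f≗g = cong₂ _+ᶻ_ (f≗g x) (∑ₗ-cong L f≗g)

  ∑ₗ-++ : ∀ (L M : List A) f → ∑ₗ (L ++ M) f ≡ ∑ₗ L f +ᶻ ∑ₗ M f
  ∑ₗ-++ []      M f = sym (ℤ.+-identityˡ _)
  ∑ₗ-++ (x ∷ L) M f = trans (cong (f x +ᶻ_) (∑ₗ-++ L M f)) (sym (ℤ.+-assoc (f x) _ _))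

  ∑ₗ-map : ∀ {B : Set} (L : List B) (g : B → A) f → ∑ₗ (map g L) f ≡ ∑ₗ L (f ∘ g)
  ∑ₗ-map []      g f = refl
  ∑ₗ-map (x ∷ L) g f = cong (f (g x) +ᶻ_) (∑ₗ-map L g f)

  ∑ₗ-concatMap : ∀ {B : Set} (L : List B) (g : B → List A) f →
                 ∑ₗ (concatMap g L) f ≡ ∑[ x ∈ L ] ∑ₗ (g x) f
  ∑ₗ-concatMap []      g f = refl
  ∑ₗ-concatMap (x ∷ L) g f = trans (∑ₗ-++ (g x) _ f) (cong (∑ₗ (g x) f +ᶻ_) (∑ₗ-concatMap L g f))

  *-distribˡ-∑ₗ : ∀ (L : List A) a f → a *ᶻ ∑ₗ L f ≡ ∑[ x ∈ L ] (a *ᶻ f x)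
  *-distribˡ-∑ₗ []      a f = ℤ.*-zeroʳ a
  *-distribˡ-∑ₗ (x ∷ L) a f =
    trans (ℤ.*-distribˡ-+ a (f x) _) (cong (a *ᶻ f x +ᶻ_) (*-distribˡ-∑ₗ L a f))

  ∑-∑ₗ-comm : ∀ {s} (L : List A) (f : Fin s → A → ℤ) →
              ∑[ i < s ] ∑ₗ L (f i) ≡ ∑[ x ∈ L ] ∑[ i < s ] f i x
  ∑-∑ₗ-comm {zero}  []      f = refl
  ∑-∑ₗ-comm {zero}  (x ∷ L) f = trans (∑-∑ₗ-comm L f) (sym (ℤ.+-identityˡ _))
  ∑-∑ₗ-comm {suc s} L       f = trans (cong (∑ₗ L (f zero) +ᶻ_) (∑-∑ₗ-comm L (f ∘ suc)))
                                      (sym (∑ₗ-distrib-+ L))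
    where
      ∑ₗ-distrib-+ : ∀ (M : List A) →
                     ∑[ x ∈ M ] (f zero x +ᶻ ∑[ i < s ] f (suc i) x)
                       ≡ ∑ₗ M (f zero) +ᶻ (∑[ x ∈ M ] ∑[ i < s ] f (suc i) x)
      ∑ₗ-distrib-+ []      = refl
      ∑ₗ-distrib-+ (x ∷ M) = trans (cong (f zero x +ᶻ ∑[ i < s ] f (suc i) x +ᶻ_) (∑ₗ-distrib-+ M))
                                     (interchange (f zero x) _ _ _)
        where interchange : ∀ a b c d → a +ᶻ b +ᶻ (c +ᶻ d) ≡ a +ᶻ c +ᶻ (b +ᶻ d)
              interchange = solve-∀

∑-linear : ∀ {s} a b (f g : Vector ℤ s) →
           ∑[ i < s ] (a *ᶻ f i +ᶻ b *ᶻ g i) ≡ a *ᶻ sum f +ᶻ b *ᶻ sum g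
∑-linear a b f g = trans (∑-distrib-+ (λ i → a *ᶻ f i) (λ i → b *ᶻ g i))
                         (sym (cong₂ _+ᶻ_ (*-distribˡ-sum a f) (*-distribˡ-sum b g)))

∑-∑ₗ-pull : ∀ {A : Set} {s} (L : List A) (f : Fin s → ℤ) (k : A → ℤ) (m : Fin s → A → ℤ) →
  ∑[ u < s ] (f u *ᶻ (∑[ t ∈ L ] (k t *ᶻ m u t))) ≡ ∑[ t ∈ L ] (k t *ᶻ ∑[ u < s ] (f u *ᶻ m u t))
∑-∑ₗ-pull {s = s} L f k m = begin
  ∑[ u < s ] (f u *ᶻ (∑[ t ∈ L ] (k t *ᶻ m u t)))
    ≡⟨ sum-cong-≗ (λ u → *-distribˡ-∑ₗ L (f u) _) ⟩
  ∑[ u < s ] (∑[ t ∈ L ] (f u *ᶻ (k t *ᶻ m u t)))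
    ≡⟨ ∑-∑ₗ-comm L (λ u t → f u *ᶻ (k t *ᶻ m u t)) ⟩
  ∑[ t ∈ L ] ∑[ u < s ] (f u *ᶻ (k t *ᶻ m u t))
    ≡⟨ ∑ₗ-cong L (λ t → sum-cong-≗ (λ u → swap (f u) (k t) (m u t))) ⟩
  ∑[ t ∈ L ] ∑[ u < s ] (k t *ᶻ (f u *ᶻ m u t))
    ≡⟨ ∑ₗ-cong L (λ t → *-distribˡ-sum (k t) (λ u → f u *ᶻ m u t)) ⟨
  ∑[ t ∈ L ] (k t *ᶻ ∑[ u < s ] (f u *ᶻ m u t))     ∎
  where
    open ≡-Reasoning
    swap : ∀ a b c → a *ᶻ (b *ᶻ c) ≡ b *ᶻ (a *ᶻ c)
    swap = solve-∀

δ : ∀ {m} → Fin m → Fin m → ℤ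
δ zero    zero    = 1ℤ
δ zero    (suc _) = 0ℤ
δ (suc _) zero    = 0ℤ
δ (suc k) (suc j) = δ k j

sum-δ : ∀ {m} (k : Fin m) (F : Fin m → ℤ) → ∑[ j < m ] (δ k j *ᶻ F j) ≡ F k
sum-δ {suc m} zero    F = begin
  1ℤ *ᶻ F zero +ᶻ ∑[ j < m ] (0ℤ *ᶻ F (suc j))  ≡⟨ cong₂ _+ᶻ_ (ℤ.*-identityˡ (F zero))
                                                   (trans (sum-cong-≗ (λ j → ℤ.*-zeroˡ (F (suc j))))
                                                          (sum-replicate-zero m)) ⟩
  F zero +ᶻ 0ℤ                                  ≡⟨ ℤ.+-identityʳ (F zero) ⟩
  F zero                                        ∎
  where open ≡-Reasoning
sum-δ {suc m} (suc k) F = trans (ℤ.+-identityˡ _) (sum-δ k (F ∘ suc))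

m∸1<m : ∀ m .{{_ : NonZero m}} → m ∸ 1 < m
m∸1<m (suc m) = ℕ.n<1+n m

three-budget : ∀ {s e x y} → s ≤ e + x → s ≤ e + e + y → y + x ≤ s → s ≤ 3 * e
three-budget {s} {e} {x} {y} s≤e+x s≤2e+y y+x≤s = ℕ.+-cancelʳ-≤ s s (3 * e) (begin
  s + s                  ≤⟨ ℕ.+-mono-≤ s≤e+x s≤2e+y ⟩
  e + x + (e + e + y)    ≡⟨ rearrange e x y ⟩
  3 * e + (y + x)        ≤⟨ ℕ.+-monoʳ-≤ (3 * e) y+x≤s ⟩
  3 * e + s              ∎)
  where
    open ℕ.≤-Reasoning
    rearrange : ∀ e x y → e + x + (e + e + y) ≡ 3 * e + (y + x)
    rearrange = solve-∀ᴺ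

module Congruence (p : ℕ) where

  infix 4 _≡0 _≡ₚ_

  _≡0 : ℤ → Set
  x ≡0 = + p ∣ x

  _≡ₚ_ : ℤ → ℤ → Set
  x ≡ₚ y = x -ᶻ y ≡0

  0≡0 : 0ℤ ≡0
  0≡0 = divides 0ℤ refl

  ≡0? : ∀ x → Dec (x ≡0)
  ≡0? x = Dec.map′ ∣ᵤ⇒∣ ∣⇒∣ᵤ (p ∣ℕ? ∣ x ∣)

  ≡ₚ-refl : ∀ x → x ≡ₚ x
  ≡ₚ-refl x = subst _≡0 (sym (ℤ.+-inverseʳ x)) 0≡0

  ≡⇒≡ₚ : ∀ {x y} → x ≡ y → x ≡ₚ y
  ≡⇒≡ₚ {x} refl = ≡ₚ-refl x

  ≡ₚ-*ˡ : ∀ a {x y} → x ≡ₚ y → a *ᶻ x ≡ₚ a *ᶻ y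
  ≡ₚ-*ˡ a {x} {y} x≡y = subst _≡0 (distrib a x y) (∣n⇒∣m*n a x≡y)
    where distrib : ∀ a x y → a *ᶻ (x -ᶻ y) ≡ a *ᶻ x -ᶻ a *ᶻ y
          distrib = solve-∀

  ≡ₚ-sym : ∀ {x y} → x ≡ₚ y → y ≡ₚ x
  ≡ₚ-sym {x} {y} x≡y = subst _≡0 (negate x y) (∣m⇒∣-m x≡y)
    where negate : ∀ x y → -ᶻ (x -ᶻ y) ≡ y -ᶻ x
          negate = solve-∀

  ≡ₚ-trans : ∀ {x y z} → x ≡ₚ y → y ≡ₚ z → x ≡ₚ z
  ≡ₚ-trans {x} {y} {z} x≡y y≡z = subst _≡0 (telescope x y z) (∣m∣n⇒∣m+n x≡y y≡z)
    where telescope : ∀ x y z → (x -ᶻ y) +ᶻ (y -ᶻ z) ≡ x -ᶻ z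
          telescope = solve-∀

  ≡ₚ-≡0 : ∀ {x y} → x ≡ₚ y → x ≡0 → y ≡0
  ≡ₚ-≡0 {x} {y} x≡y x≡0 = subst _≡0 (cancel x y) (∣m∣n⇒∣m-n x≡0 x≡y)
    where cancel : ∀ x y → x -ᶻ (x -ᶻ y) ≡ y
          cancel = solve-∀

  sum-≡0 : ∀ {s} (f : Fin s → ℤ) → (∀ i → f i ≡0) → sum f ≡0
  sum-≡0 {zero}  f f≡0 = 0≡0
  sum-≡0 {suc s} f f≡0 = ∣m∣n⇒∣m+n (f≡0 zero) (sum-≡0 (f ∘ suc) (f≡0 ∘ suc))

  sum-≡ₚ-single : ∀ {s} (f : Fin s → ℤ) i → (∀ j → j ≢ i → f j ≡0) → sum f ≡ₚ f i
  sum-≡ₚ-single {suc _} f i off-i = subst _≡0 (sym (sum-minus-point (sum-remove {i = i} f)))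
    (sum-≡0 (removeAt f i) (λ j → off-i (punchIn i j) (punchInᵢ≢i i j)))
    where
      cancel : ∀ a b → a +ᶻ b -ᶻ a ≡ b
      cancel = solve-∀
      sum-minus-point : ∀ {c a b} → c ≡ a +ᶻ b → c -ᶻ a ≡ b
      sum-minus-point {a = a} {b} refl = cancel a b

  ∑ₗ-≡ₚ : ∀ {A : Set} (L : List A) {f g : A → ℤ} → All (λ x → f x ≡ₚ g x) L → ∑ₗ L f ≡ₚ ∑ₗ L g
  ∑ₗ-≡ₚ []      []             = ≡ₚ-refl 0ℤ
  ∑ₗ-≡ₚ (x ∷ L) {f} {g} (fx≡gx ∷ f≡g) =
    subst _≡0 (interchange (f x) (g x) _ _) (∣m∣n⇒∣m+n fx≡gx (∑ₗ-≡ₚ L f≡g))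
    where interchange : ∀ a b c d → a -ᶻ b +ᶻ (c -ᶻ d) ≡ a +ᶻ c -ᶻ (b +ᶻ d)
          interchange = solve-∀

  support : ∀ {s} → Vector ℤ s → ℕ
  support {zero}  f = 0
  support {suc s} f with ≡0? (f zero)
  ... | yes _ = support (tail f)
  ... | no  _ = suc (support (tail f))

  support-cong : ∀ {s} (f g : Vector ℤ s) → (∀ i → f i ≡0 → g i ≡0) → (∀ i → g i ≡0 → f i ≡0) →
                 support f ≡ support g
  support-cong {zero}  f g f⇒g g⇒f = refl
  support-cong {suc s} f g f⇒g g⇒f with ≡0? (f zero) | ≡0? (g zero)
  ... | yes _   | yes _   = support-cong (tail f) (tail g) (f⇒g ∘ suc) (g⇒f ∘ suc)
  ... | yes f₀  | no  ¬g₀ = contradiction (f⇒g zero f₀) ¬g₀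
  ... | no  ¬f₀ | yes g₀  = contradiction (g⇒f zero g₀) ¬f₀
  ... | no  _   | no  _   = cong suc (support-cong (tail f) (tail g) (f⇒g ∘ suc) (g⇒f ∘ suc))

  support-tail : ∀ {s} (f : Vector ℤ (suc s)) → support (tail f) ≤ support f
  support-tail f with ≡0? (f zero)
  ... | yes _ = ℕ.≤-refl
  ... | no  _ = ℕ.n≤1+n _

  support-disjoint : ∀ {s} (f g : Vector ℤ s) → (∀ i → f i ≡0 ⊎ g i ≡0) → support f + support g ≤ s
  support-disjoint {zero}  f g f⊎g = z≤n
  support-disjoint {suc s} f g f⊎g with ≡0? (f zero) | ≡0? (g zero) | f⊎g zero
  ... | yes _   | yes _   | _      = ℕ.m≤n⇒m≤1+n (support-disjoint (tail f) (tail g) (f⊎g ∘ suc))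
  ... | yes _   | no  _   | _      = subst (_≤ suc s) (sym (ℕ.+-suc _ _))
                                        (s≤s (support-disjoint (tail f) (tail g) (f⊎g ∘ suc)))
  ... | no  _   | yes _   | _      = s≤s (support-disjoint (tail f) (tail g) (f⊎g ∘ suc))
  ... | no  ¬f₀ | no  _   | inj₁ f₀ = contradiction f₀ ¬f₀
  ... | no  _   | no  ¬g₀ | inj₂ g₀ = contradiction g₀ ¬g₀

module PrimeModulus (p : ℕ) (p-prime : Prime p) where

  open Congruence p

  1≢0 : ¬ 1ℤ ≡0
  1≢0 p∣1 = ¬prime[1] (subst Prime (∣1⇒≡1 (∣⇒∣ᵤ p∣1)) p-prime)

  ≡0-*⁻ : ∀ x y → x *ᶻ y ≡0 → x ≡0 ⊎ y ≡0
  ≡0-*⁻ x y p∣xy with euclidsLemma ∣ x ∣ ∣ y ∣ p-prime (subst (p ∣ℕ_) (ℤ.abs-* x y) (∣⇒∣ᵤ p∣xy))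
  ... | inj₁ p∣x = inj₁ (∣ᵤ⇒∣ p∣x)
  ... | inj₂ p∣y = inj₂ (∣ᵤ⇒∣ p∣y)

  ≢0-* : ∀ {x y} → ¬ x ≡0 → ¬ y ≡0 → ¬ x *ᶻ y ≡0
  ≢0-* {x} {y} x≢0 y≢0 xy≡0 = [ x≢0 , y≢0 ]′ (≡0-*⁻ x y xy≡0)

  support-∷-≢0 : ∀ {s} {a} (f : Vector ℤ s) → ¬ a ≡0 → support (a ∷ᶠ f) ≡ suc (support f)
  support-∷-≢0 {a = a} f a≢0 with ≡0? a
  ... | yes a≡0 = contradiction a≡0 a≢0
  ... | no  _   = refl

  support-*-≢0 : ∀ {s} {c} (f : Vector ℤ s) → ¬ c ≡0 → support (λ i → c *ᶻ f i) ≡ support f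
  support-*-≢0 {c = c} f c≢0 = support-cong _ f
    (λ i cf≡0 → [ (λ c≡0 → contradiction c≡0 c≢0) , (λ f≡0 → f≡0) ]′ (≡0-*⁻ c (f i) cf≡0))
    (λ i → ∣n⇒∣m*n c)

  infix 4 _⟂_

  _⟂_ : ∀ {s} → Vector ℤ s → Vector ℤ s → Set
  _⟂_ {s} h φ = ∑[ u < s ] (h u *ᶻ φ u) ≡0

  record LargeOrthogonal {s} (L : List (Vector ℤ s)) : Set where
    field
      vector        : Vector ℤ s
      orthogonal    : All (vector ⟂_) L
      large-support : s ≤ length L + support vector

  extend-by-one : ∀ {s} (L : List (Vector ℤ (suc s))) → All (λ φ → φ zero ≡0) L →
                  LargeOrthogonal (map tail L) → LargeOrthogonal L
  extend-by-one {s} L heads≡0 record { vector = h ; orthogonal = h⟂ ; large-support = large } = record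
    { vector        = 1ℤ ∷ᶠ h
    ; orthogonal    = All.zipWith (λ (φ₀≡0 , h⟂φ) → ∣m∣n⇒∣m+n (∣n⇒∣m*n 1ℤ φ₀≡0) h⟂φ) (heads≡0 , map⁻ h⟂)
    ; large-support = begin
        suc s                                   ≤⟨ s≤s large ⟩
        suc (length (map tail L) + support h)   ≡⟨ cong (λ k → suc (k + support h)) (length-map tail L) ⟩
        suc (length L + support h)              ≡⟨ ℕ.+-suc (length L) (support h) ⟨
        length L + suc (support h)              ≡⟨ cong (λ k → length L + k) (support-∷-≢0 h 1≢0) ⟨
        length L + support (1ℤ ∷ᶠ h)             ∎
    }
    where open ℕ.≤-Reasoning

  -- Division-free elimination of the first coordinate against a pivot c with c₀ ≢ 0 (mod p).
  eliminate : ∀ {s} → Vector ℤ (suc s) → Vector ℤ (suc s) → Vector ℤ s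
  eliminate c φ i = c zero *ᶻ φ (suc i) -ᶻ φ zero *ᶻ c (suc i)

  lift-pivot : ∀ {s} → Vector ℤ (suc s) → Vector ℤ s → Vector ℤ (suc s)
  lift-pivot {s} c h = -ᶻ (∑[ i < s ] (h i *ᶻ c (suc i))) ∷ᶠ (λ i → c zero *ᶻ h i)

  lift-pivot-pairing : ∀ {s} c (h : Vector ℤ s) φ →
    ∑[ u < suc s ] (lift-pivot c h u *ᶻ φ u) ≡ ∑[ i < s ] (h i *ᶻ eliminate c φ i)
  lift-pivot-pairing {s} c h φ = begin
    -ᶻ S *ᶻ φ₀ +ᶻ ∑[ i < s ] (c₀ *ᶻ h i *ᶻ φ (suc i))
      ≡⟨ cong (-ᶻ S *ᶻ φ₀ +ᶻ_) (trans (sum-cong-≗ (λ i → ℤ.*-assoc c₀ (h i) _))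
                                       (sym (*-distribˡ-sum c₀ hφ))) ⟩
    -ᶻ S *ᶻ φ₀ +ᶻ c₀ *ᶻ sum hφ
      ≡⟨ reorder S φ₀ c₀ (sum hφ) ⟩
    c₀ *ᶻ sum hφ +ᶻ -ᶻ φ₀ *ᶻ S
      ≡⟨ ∑-linear c₀ (-ᶻ φ₀) hφ (λ i → h i *ᶻ c (suc i)) ⟨
    ∑[ i < s ] (c₀ *ᶻ hφ i +ᶻ -ᶻ φ₀ *ᶻ (h i *ᶻ c (suc i)))
      ≡⟨ sum-cong-≗ (λ i → expand c₀ φ₀ (h i) (φ (suc i)) (c (suc i))) ⟩
    ∑[ i < s ] (h i *ᶻ eliminate c φ i) ∎
    where
      open ≡-Reasoning
      c₀ = c zero
      φ₀ = φ zero
      S = ∑[ i < s ] (h i *ᶻ c (suc i))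
      hφ : Vector ℤ s
      hφ i = h i *ᶻ φ (suc i)
      reorder : ∀ S φ₀ c₀ T → -ᶻ S *ᶻ φ₀ +ᶻ c₀ *ᶻ T ≡ c₀ *ᶻ T +ᶻ -ᶻ φ₀ *ᶻ S
      reorder = solve-∀
      expand : ∀ c₀ φ₀ x y z → c₀ *ᶻ (x *ᶻ y) +ᶻ -ᶻ φ₀ *ᶻ (x *ᶻ z) ≡ x *ᶻ (c₀ *ᶻ y -ᶻ φ₀ *ᶻ z)
      expand = solve-∀

  eliminate-pivot : ∀ {s} (L : List (Vector ℤ (suc s))) (pivot : Any (λ φ → ¬ φ zero ≡0) L) →
                    LargeOrthogonal (map (eliminate (Any.lookup pivot)) (L ─ pivot)) → LargeOrthogonal L
  eliminate-pivot {s} L pivot record { vector = h ; orthogonal = h⟂ ; large-support = large } = record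
    { vector        = lift-pivot c h
    ; orthogonal    = ─⁻ pivot (lifted⟂ c c⟂c) (All.map (λ {φ} → lifted⟂ φ) (map⁻ h⟂))
    ; large-support = begin
        suc s                                      ≤⟨ s≤s large ⟩
        suc (length (map (eliminate c) rest) + support h)
                                                   ≡⟨ cong (λ k → suc (k + support h)) (length-map _ rest) ⟩
        suc (length rest) + support h
                                   ≡⟨ cong (_+ support h) (length-removeAt′ L (Any.index pivot)) ⟨
        length L + support h                       ≡⟨ cong (λ k → length L + k) (support-*-≢0 h c₀≢0) ⟨
        length L + support (tail (lift-pivot c h)) ≤⟨ ℕ.+-monoʳ-≤ (length L) (support-tail (lift-pivot c h)) ⟩
        length L + support (lift-pivot c h)        ∎
    }
    where
      open ℕ.≤-Reasoning
      c = Any.lookup pivot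
      c₀≢0 = lookup-result pivot
      rest = L ─ pivot
      lifted⟂ : ∀ φ → h ⟂ eliminate c φ → lift-pivot c h ⟂ φ
      lifted⟂ φ = subst _≡0 (sym (lift-pivot-pairing c h φ))
      self-eliminated : ∀ x a b → 0ℤ ≡ x *ᶻ (a *ᶻ b -ᶻ a *ᶻ b)
      self-eliminated = solve-∀
      c⟂c : h ⟂ eliminate c c
      c⟂c = sum-≡0 _ (λ i → subst _≡0 (self-eliminated (h i) (c zero) (c (suc i))) 0≡0)

  large-orthogonal : ∀ {s} (L : List (Vector ℤ s)) → LargeOrthogonal L
  large-orthogonal {zero}  L = record
    { vector = λ () ; orthogonal = All.universal (λ _ → 0≡0) L ; large-support = z≤n }
  large-orthogonal {suc s} L with all? (λ φ → ≡0? (φ zero)) L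
  ... | yes heads≡0 = extend-by-one L heads≡0 (large-orthogonal (map tail L))
  ... | no ¬heads≡0 =
    eliminate-pivot L pivot (large-orthogonal (map (eliminate (Any.lookup pivot)) (L ─ pivot)))
    where pivot = ¬All⇒Any¬ (λ φ → ≡0? (φ zero)) L ¬heads≡0

q : ℕ → ℤ → ℤ
q zero    u = 1ℤ
q (suc k) u = (u -ᶻ + suc k) *ᶻ q k u

Term₁ : Set
Term₁ = ℤ × ℕ × ℕ × ℕ

eval₁ : ℤ → ℤ → ℤ → Term₁ → ℤ
eval₁ x y z (c , a , b , e) = c *ᶻ x ^ᶻ a *ᶻ y ^ᶻ b *ᶻ z ^ᶻ e

degree₁ : Term₁ → ℕ
degree₁ (c , a , b , e) = a + b + e

times-linear : ℕ → Term₁ → List Term₁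
times-linear r (c , a , b , e) =
  (c , suc a , b , e) ∷ (c , a , suc b , e) ∷ (-ᶻ c , a , b , suc e) ∷ (-ᶻ + r *ᶻ c , a , b , e) ∷ []

times-linear-correct : ∀ x y z r t →
  ∑[ t′ ∈ times-linear r t ] eval₁ x y z t′ ≡ (x +ᶻ y -ᶻ z -ᶻ + r) *ᶻ eval₁ x y z t
times-linear-correct x y z r (c , a , b , e) = distribute c x y z (+ r) (x ^ᶻ a) (y ^ᶻ b) (z ^ᶻ e)
  where distribute : ∀ c x y z r X Y W →
          c *ᶻ (x *ᶻ X) *ᶻ Y *ᶻ W +ᶻ (c *ᶻ X *ᶻ (y *ᶻ Y) *ᶻ W +ᶻ
            (-ᶻ c *ᶻ X *ᶻ Y *ᶻ (z *ᶻ W) +ᶻ (-ᶻ r *ᶻ c *ᶻ X *ᶻ Y *ᶻ W +ᶻ 0ℤ)))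
          ≡ (x +ᶻ y -ᶻ z -ᶻ r) *ᶻ (c *ᶻ X *ᶻ Y *ᶻ W)
        distribute = solve-∀

times-linear-degree : ∀ {k} t → degree₁ t ≤ k → All (λ t′ → degree₁ t′ ≤ suc k) (times-linear (suc k) t)
times-linear-degree {k} (c , a , b , e) deg≤k =
  s≤s deg≤k ∷ subst (_≤ suc k) (cong (_+ e) (sym (ℕ.+-suc a b))) (s≤s deg≤k) ∷
  subst (_≤ suc k) (sym (ℕ.+-suc (a + b) e)) (s≤s deg≤k) ∷ ℕ.m≤n⇒m≤1+n deg≤k ∷ []

expansion₁ : ℕ → List Term₁
expansion₁ zero    = (1ℤ , 0 , 0 , 0) ∷ []
expansion₁ (suc k) = concatMap (times-linear (suc k)) (expansion₁ k)

expansion₁-correct : ∀ x y z k → ∑[ t ∈ expansion₁ k ] eval₁ x y z t ≡ q k (x +ᶻ y -ᶻ z)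
expansion₁-correct x y z zero    = refl
expansion₁-correct x y z (suc k) = begin
  ∑ₗ (concatMap (times-linear (suc k)) (expansion₁ k)) (eval₁ x y z)
    ≡⟨ ∑ₗ-concatMap (expansion₁ k) (times-linear (suc k)) (eval₁ x y z) ⟩
  ∑[ t ∈ expansion₁ k ] ∑ₗ (times-linear (suc k) t) (eval₁ x y z)
    ≡⟨ ∑ₗ-cong (expansion₁ k) (times-linear-correct x y z (suc k)) ⟩
  ∑[ t ∈ expansion₁ k ] (u-r *ᶻ eval₁ x y z t)
    ≡⟨ *-distribˡ-∑ₗ (expansion₁ k) u-r (eval₁ x y z) ⟨
  u-r *ᶻ ∑ₗ (expansion₁ k) (eval₁ x y z)
    ≡⟨ cong (u-r *ᶻ_) (expansion₁-correct x y z k) ⟩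
  u-r *ᶻ q k (x +ᶻ y -ᶻ z) ∎
  where
    open ≡-Reasoning
    u-r = x +ᶻ y -ᶻ z -ᶻ + suc k

expansion₁-degree : ∀ k → All (λ t → degree₁ t ≤ k) (expansion₁ k)
expansion₁-degree zero    = z≤n ∷ []
expansion₁-degree (suc k) =
  concat⁺ (map⁺ (All.map (λ {t} → times-linear-degree t) (expansion₁-degree k)))

Term : ℕ → Set
Term n = ℤ × Vec ℕ n × Vec ℕ n × Vec ℕ n

monomial : ∀ {n} → Vec ℤ n → Vec ℕ n → ℤ
monomial []       []      = 1ℤ
monomial (x ∷ xs) (a ∷ α) = x ^ᶻ a *ᶻ monomial xs α

eval : ∀ {n} → Vec ℤ n → Vec ℤ n → Vec ℤ n → Term n → ℤ
eval xs ys zs (c , α , β , γ) = c *ᶻ monomial xs α *ᶻ monomial ys β *ᶻ monomial zs γ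

qⁿ : ℕ → ∀ {n} → Vec ℤ n → Vec ℤ n → Vec ℤ n → ℤ
qⁿ k []       []       []       = 1ℤ
qⁿ k (x ∷ xs) (y ∷ ys) (z ∷ zs) = q k (x +ᶻ y -ᶻ z) *ᶻ qⁿ k xs ys zs

cons-term : ∀ {n} → Term₁ → Term n → Term (suc n)
cons-term (c₁ , a , b , e) (c , α , β , γ) = (c₁ *ᶻ c , a ∷ α , b ∷ β , e ∷ γ)

eval-cons-term : ∀ {n} x y z (xs ys zs : Vec ℤ n) t₁ t →
  eval (x ∷ xs) (y ∷ ys) (z ∷ zs) (cons-term t₁ t) ≡ eval₁ x y z t₁ *ᶻ eval xs ys zs t
eval-cons-term x y z xs ys zs (c₁ , a , b , e) (c , α , β , γ) =
  regroup c₁ c (x ^ᶻ a) (y ^ᶻ b) (z ^ᶻ e) (monomial xs α) (monomial ys β) (monomial zs γ)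
  where regroup : ∀ c₁ c X Y W A B C →
          c₁ *ᶻ c *ᶻ (X *ᶻ A) *ᶻ (Y *ᶻ B) *ᶻ (W *ᶻ C) ≡ c₁ *ᶻ X *ᶻ Y *ᶻ W *ᶻ (c *ᶻ A *ᶻ B *ᶻ C)
        regroup = solve-∀

expansion : ℕ → ∀ n → List (Term n)
expansion k zero    = (1ℤ , [] , [] , []) ∷ []
expansion k (suc n) = concatMap (λ t₁ → map (cons-term t₁) (expansion k n)) (expansion₁ k)

expansion-correct : ∀ k {n} (xs ys zs : Vec ℤ n) → ∑[ t ∈ expansion k n ] eval xs ys zs t ≡ qⁿ k xs ys zs
expansion-correct k []       []       []       = refl
expansion-correct k {suc n} (x ∷ xs) (y ∷ ys) (z ∷ zs) = begin
  ∑ₗ (concatMap (λ t₁ → map (cons-term t₁) (expansion k n)) (expansion₁ k)) evalₛ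
    ≡⟨ ∑ₗ-concatMap (expansion₁ k) _ evalₛ ⟩
  ∑[ t₁ ∈ expansion₁ k ] ∑ₗ (map (cons-term t₁) (expansion k n)) evalₛ
    ≡⟨ ∑ₗ-cong (expansion₁ k) (λ t₁ → trans (∑ₗ-map (expansion k n) (cons-term t₁) evalₛ)
                                           (∑ₗ-cong (expansion k n) (eval-cons-term x y z xs ys zs t₁))) ⟩
  ∑[ t₁ ∈ expansion₁ k ] ∑[ t ∈ expansion k n ] (eval₁ x y z t₁ *ᶻ eval xs ys zs t)
    ≡⟨ ∑ₗ-cong (expansion₁ k) (λ t₁ → sym (*-distribˡ-∑ₗ (expansion k n) (eval₁ x y z t₁) (eval xs ys zs))) ⟩
  ∑[ t₁ ∈ expansion₁ k ] (eval₁ x y z t₁ *ᶻ ∑ₗ (expansion k n) (eval xs ys zs))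
    ≡⟨ ∑ₗ-cong (expansion₁ k) (λ t₁ → trans (cong (eval₁ x y z t₁ *ᶻ_) (expansion-correct k xs ys zs))
                                           (ℤ.*-comm (eval₁ x y z t₁) _)) ⟩
  ∑[ t₁ ∈ expansion₁ k ] (qⁿ k xs ys zs *ᶻ eval₁ x y z t₁)
    ≡⟨ *-distribˡ-∑ₗ (expansion₁ k) (qⁿ k xs ys zs) (eval₁ x y z) ⟨
  qⁿ k xs ys zs *ᶻ ∑ₗ (expansion₁ k) (eval₁ x y z)
    ≡⟨ cong (qⁿ k xs ys zs *ᶻ_) (expansion₁-correct x y z k) ⟩
  qⁿ k xs ys zs *ᶻ q k (x +ᶻ y -ᶻ z)
    ≡⟨ ℤ.*-comm (qⁿ k xs ys zs) _ ⟩
  q k (x +ᶻ y -ᶻ z) *ᶻ qⁿ k xs ys zs ∎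
  where
    open ≡-Reasoning
    evalₛ = eval (x ∷ xs) (y ∷ ys) (z ∷ zs)

Bounded : ℕ → ∀ {n} → Vec ℕ n → Vec ℕ n → Vec ℕ n → Set
Bounded k []      []      []      = ⊤
Bounded k (a ∷ α) (b ∷ β) (e ∷ γ) = a + b + e ≤ k × Bounded k α β γ

BoundedTerm : ℕ → ∀ {n} → Term n → Set
BoundedTerm k (c , α , β , γ) = Bounded k α β γ

expansion-bounded : ∀ k n → All (BoundedTerm k) (expansion k n)
expansion-bounded k zero    = tt ∷ []
expansion-bounded k (suc n) =
  concat⁺ (map⁺ (All.map (λ {t₁} deg≤k → map⁺ (All.map (λ {t} → cons-bounded t₁ t deg≤k)
                                                         (expansion-bounded k n)))
                         (expansion₁-degree k)))
  where cons-bounded : ∀ t₁ t → degree₁ t₁ ≤ k → BoundedTerm k t → BoundedTerm k (cons-term t₁ t)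
        cons-bounded (c₁ , a , b , e) (c , α , β , γ) deg≤k bounded = deg≤k , bounded

Bounded-sum : ∀ k {n} (α β γ : Vec ℕ n) → Bounded k α β γ → Vec.sum α + Vec.sum β + Vec.sum γ ≤ k * n
Bounded-sum k []      []      []      _                 = z≤n
Bounded-sum k {suc n} (a ∷ α) (b ∷ β) (e ∷ γ) (abe≤k , bounded) = begin
  a + Vec.sum α + (b + Vec.sum β) + (e + Vec.sum γ)   ≡⟨ interchange a b e (Vec.sum α) (Vec.sum β) (Vec.sum γ) ⟩
  a + b + e + (Vec.sum α + Vec.sum β + Vec.sum γ)     ≤⟨ ℕ.+-mono-≤ abe≤k (Bounded-sum k α β γ bounded) ⟩
  k + k * n                                           ≡⟨ ℕ.*-suc k n ⟨
  k * suc n                                           ∎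
  where
    open ℕ.≤-Reasoning
    interchange : ∀ a b e x y z → a + x + (b + y) + (e + z) ≡ a + b + e + (x + y + z)
    interchange = solve-∀ᴺ

pigeonhole : ∀ k {n} (α β γ : Vec ℕ n) → Bounded k α β γ →
             (k * n) / 3 < Vec.sum α → (k * n) / 3 < Vec.sum β → (k * n) / 3 < Vec.sum γ → ⊥
pigeonhole k {n} α β γ bounded d<α d<β d<γ = ℕ.<-irrefl refl (begin-strict
  d                 <⟨ ℕ.n<1+n d ⟩
  suc d             ≡⟨ m*n/n≡m (suc d) 3 ⟨
  suc d * 3 / 3     ≤⟨ /-monoˡ-≤ 3 three-slices ⟩
  d                 ∎)
  where
    open ℕ.≤-Reasoning
    d = (k * n) / 3
    triple : ∀ x → x * 3 ≡ x + x + x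
    triple = solve-∀ᴺ
    three-slices : suc d * 3 ≤ k * n
    three-slices = begin
      suc d * 3                               ≡⟨ triple (suc d) ⟩
      suc d + suc d + suc d                   ≤⟨ ℕ.+-mono-≤ (ℕ.+-mono-≤ d<α d<β) d<γ ⟩
      Vec.sum α + Vec.sum β + Vec.sum γ       ≤⟨ Bounded-sum k α β γ bounded ⟩
      k * n                                   ∎

Bounded-components : ∀ k {n} (α β γ : Vec ℕ n) → Bounded k α β γ →
                     VAll (_≤ k) α × VAll (_≤ k) β × VAll (_≤ k) γ
Bounded-components k []      []      []      _                 = [] , [] , []
Bounded-components k (a ∷ α) (b ∷ β) (e ∷ γ) (abe≤k , bounded) =
  ℕ.≤-trans (ℕ.≤-trans (ℕ.m≤m+n a b) (ℕ.m≤m+n (a + b) e)) abe≤k ∷ α≤k ,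
  ℕ.≤-trans (ℕ.≤-trans (ℕ.m≤n+m b a) (ℕ.m≤m+n (a + b) e)) abe≤k ∷ β≤k ,
  ℕ.≤-trans (ℕ.m≤n+m e (a + b)) abe≤k ∷ γ≤k
  where
    α≤k = proj₁ (Bounded-components k α β γ bounded)
    β≤k = proj₁ (proj₂ (Bounded-components k α β γ bounded))
    γ≤k = proj₂ (proj₂ (Bounded-components k α β γ bounded))

coeff : ∀ {n} → Term n → ℤ
coeff (c , _ , _ , _) = c

expα expβ expγ : ∀ {n} → Term n → Vec ℕ n
expα (_ , α , _ , _) = α
expβ (_ , _ , β , _) = β
expγ (_ , _ , _ , γ) = γ

module Residues (p : ℕ) .{{_ : NonZero p}} where

  open Congruence p

  multiple-below : ∀ {x} → x < p → + x ≡0 → x ≡ 0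
  multiple-below {x} x<p p∣x = trans (sym (m<n⇒m%n≡m x<p)) (n∣m⇒m%n≡0 x p (∣⇒∣ᵤ p∣x))

  ≤-residue-unique : ∀ {r c} → r ≤ c → c < p → + c ≡ₚ + r → r ≡ c
  ≤-residue-unique {r} {c} r≤c c<p c≡r = ℕ.≤-antisym r≤c (ℕ.m∸n≡0⇒m≤n
    (multiple-below (ℕ.≤-<-trans (ℕ.m∸n≤m c r) c<p) (subst _≡0 (trans (ℤ.[+m]-[+n]≡m⊖n c r) (ℤ.⊖-≥ r≤c)) c≡r)))

  residue-unique : ∀ {r c} → r < p → c < p → + r ≡ₚ + c → r ≡ c
  residue-unique {r} {c} r<p c<p r≡c with ℕ.≤-total r c
  ... | inj₁ r≤c = ≤-residue-unique r≤c c<p (≡ₚ-sym {+ r} {+ c} r≡c)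
  ... | inj₂ c≤r = sym (≤-residue-unique c≤r r<p r≡c)

  ≡ₚ-%ℕ : ∀ u → u ≡ₚ + (u %ℕ p)
  ≡ₚ-%ℕ u = divides (u /ℕ p) (trans (cong (_-ᶻ + (u %ℕ p)) (a≡a%ℕn+[a/ℕn]*n u p)) (cancel (+ (u %ℕ p)) _))
    where cancel : ∀ a b → a +ᶻ b -ᶻ a ≡ b
          cancel = solve-∀

  ≡0-or-residue : ∀ u → u ≡0 ⊎ ∃[ r ] 1 ≤ r × r ≤ p ∸ 1 × u ≡ₚ + r
  ≡0-or-residue u with u %ℕ p | n%ℕd<d u p | ≡ₚ-%ℕ u
  ... | zero  | _   | u≡0 = inj₁ (subst _≡0 (ℤ.+-identityʳ u) u≡0)
  ... | suc r | r<p | u≡r = inj₂ (suc r , s≤s z≤n , ℕ.∸-monoˡ-≤ 1 r<p , u≡r)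

  toℤ : Fin p → ℤ
  toℤ i = + toℕ i

  +ₚ-≡ₚ : ∀ a b → toℤ a +ᶻ toℤ b ≡ₚ toℤ (a +ₚ b)
  +ₚ-≡ₚ a b = subst₂ _≡ₚ_ (ℤ.pos-+ (toℕ a) (toℕ b)) (cong +_ (sym (toℕ-fromℕ< (m%n<n N p)))) (≡ₚ-%ℕ (+ N))
    where N = toℕ a + toℕ b

  ≡ₚ⇒+ₚ : ∀ a b c → toℤ a +ᶻ toℤ b ≡ₚ toℤ c → a +ₚ b ≡ c
  ≡ₚ⇒+ₚ a b c a+b≡c = toℕ-injective (residue-unique (toℕ<n (a +ₚ b)) (toℕ<n c)
    (≡ₚ-trans {toℤ (a +ₚ b)} {toℤ a +ᶻ toℤ b} {toℤ c}
              (≡ₚ-sym {toℤ a +ᶻ toℤ b} {toℤ (a +ₚ b)} (+ₚ-≡ₚ a b)) a+b≡c))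

module Diagonal (p : ℕ) .{{_ : NonZero p}} (p-prime : Prime p) where

  open Congruence p
  open PrimeModulus p p-prime
  open Residues p public

  q-≡0 : ∀ u k {r} → 1 ≤ r → r ≤ k → u ≡ₚ + r → q k u ≡0
  q-≡0 u zero            1≤r r≤0 _   = contradiction r≤0 (ℕ.<⇒≱ 1≤r)
  q-≡0 u (suc k) {r} 1≤r r≤k u≡r with r ℕ.≟ suc k
  ... | yes refl = ∣m⇒∣m*n (q k u) u≡r
  ... | no  r≢k  = ∣n⇒∣m*n (u -ᶻ + suc k) (q-≡0 u k 1≤r (ℕ.≤-pred (ℕ.≤∧≢⇒< r≤k r≢k)) u≡r)

  q-≢0 : ∀ {u} k → u ≡0 → k < p → ¬ q k u ≡0
  q-≢0     zero    u≡0 k<p = 1≢0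
  q-≢0 {u} (suc k) u≡0 k<p = ≢0-* u≢k+1 (q-≢0 k u≡0 (ℕ.<-trans (ℕ.n<1+n k) k<p))
    where
      cancel : ∀ u r → u -ᶻ (u -ᶻ r) ≡ r
      cancel = solve-∀
      u≢k+1 : ¬ u ≡ₚ + suc k
      u≢k+1 u≡k+1 = ℕ.1+n≢0 (multiple-below k<p (subst _≡0 (cancel u (+ suc k)) (∣m∣n⇒∣m-n u≡0 u≡k+1)))

  q-diagonal : ∀ a b c → a +ₚ b ≡ c → ¬ q (p ∸ 1) (toℤ a +ᶻ toℤ b -ᶻ toℤ c) ≡0
  q-diagonal a b c refl = q-≢0 (p ∸ 1) (+ₚ-≡ₚ a b) (m∸1<m p)

  q-off-diagonal : ∀ a b c → a +ₚ b ≢ c → q (p ∸ 1) (toℤ a +ᶻ toℤ b -ᶻ toℤ c) ≡0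
  q-off-diagonal a b c a+b≢c with ≡0-or-residue (toℤ a +ᶻ toℤ b -ᶻ toℤ c)
  ... | inj₁ a+b≡c               = contradiction (≡ₚ⇒+ₚ a b c a+b≡c) a+b≢c
  ... | inj₂ (r , 1≤r , r≤k , u≡r) = q-≡0 _ (p ∸ 1) 1≤r r≤k u≡r

  toℤᵛ : ∀ {n} → Vec (Fin p) n → Vec ℤ n
  toℤᵛ = Vec.map toℤ

  D : ∀ {n} → Vec (Fin p) n → Vec (Fin p) n → Vec (Fin p) n → ℤ
  D a b c = qⁿ (p ∸ 1) (toℤᵛ a) (toℤᵛ b) (toℤᵛ c)

  D-diagonal : ∀ {n} (a b c : Vec (Fin p) n) → a ⊕ b ≡ c → ¬ D a b c ≡0
  D-diagonal []       []       []       _     = 1≢0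
  D-diagonal (x ∷ a) (y ∷ b) (z ∷ c) x∷a+y∷b≡z∷c = ≢0-* (q-diagonal x y z x+y≡z) (D-diagonal a b c a+b≡c)
    where x+y≡z = proj₁ (Vecₚ.∷-injective x∷a+y∷b≡z∷c)
          a+b≡c = proj₂ (Vecₚ.∷-injective x∷a+y∷b≡z∷c)

  D-off-diagonal : ∀ {n} (a b c : Vec (Fin p) n) → a ⊕ b ≢ c → D a b c ≡0
  D-off-diagonal []      []      []      []≢[] = contradiction refl []≢[]
  D-off-diagonal (x ∷ a) (y ∷ b) (z ∷ c) a+b≢c with (x +ₚ y) ≟ᶠ z
  ... | no  x+y≢z = ∣m⇒∣m*n (D a b c) (q-off-diagonal x y z x+y≢z)
  ... | yes x+y≡z = ∣n⇒∣m*n (q (p ∸ 1) _) (D-off-diagonal a b c (a+b≢c ∘ cong₂ _∷_ x+y≡z))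

module LowDegree (p : ℕ) .{{_ : NonZero p}} (n : ℕ) where

  d : ℕ
  d = ((p ∸ 1) * n) / 3

  E : List (Vec (Fin p) n)
  E = filter (λ α → degree α ≤? d) (allExponents p n)

  ∈-allExponents : ∀ {m} (α : Vec (Fin p) m) → α ∈ allExponents p m
  ∈-allExponents []            = here refl
  ∈-allExponents {suc m} (x ∷ α) = ∈-concatMap⁺ (λ a → map (a ∷_) (allExponents p m))
    (Any.map (λ { refl → ∈-map⁺ (x ∷_) (∈-allExponents α) }) (∈-allFin x))

  ∈-E : ∀ α → degree α ≤ d → α ∈ E
  ∈-E α deg≤d = ∈-filter⁺ (λ α → degree α ≤? d) (∈-allExponents α) deg≤d

  ↓ : ∀ {m} → Vec ℕ m → Vec (Fin p) m
  ↓ = Vec.map (_mod p)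

  ↑ : ∀ {m} → Vec (Fin p) m → Vec ℕ m
  ↑ = Vec.map toℕ

  ↑↓-below : ∀ {m} (α : Vec ℕ m) → VAll (_< p) α → ↑ (↓ α) ≡ α
  ↑↓-below []      []          = refl
  ↑↓-below (a ∷ α) (a<p ∷ α<p) = cong₂ _∷_ (trans (toℕ-fromℕ< (m%n<n a p)) (m<n⇒m%n≡m a<p)) (↑↓-below α α<p)

  degree-↑ : ∀ {m} (α : Vec (Fin p) m) → degree α ≡ Vec.sum (↑ α)
  degree-↑ []      = refl
  degree-↑ (x ∷ α) = cong (λ k → toℕ x + k) (degree-↑ α)

  ↑↓-bounded : ∀ (α β γ : Vec ℕ n) → Bounded (p ∸ 1) α β γ → ↑ (↓ α) ≡ α × ↑ (↓ β) ≡ β × ↑ (↓ γ) ≡ γ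
  ↑↓-bounded α β γ bounded with Bounded-components (p ∸ 1) α β γ bounded
  ... | α≤ , β≤ , γ≤ = ↑↓-below α (below α≤) , ↑↓-below β (below β≤) , ↑↓-below γ (below γ≤)
    where below : ∀ {m} {ξ : Vec ℕ m} → VAll (_≤ p ∸ 1) ξ → VAll (_< p) ξ
          below = VAll.map (λ x≤ → ℕ.≤-<-trans x≤ (m∸1<m p))

  no-high-term : ∀ (α β γ : Vec ℕ n) → Bounded (p ∸ 1) α β γ →
                 d < degree (↓ α) → d < degree (↓ β) → d < degree (↓ γ) → ⊥
  no-high-term α β γ bounded d<α d<β d<γ with ↑↓-bounded α β γ bounded
  ... | α≡ , β≡ , γ≡ = pigeonhole (p ∸ 1) α β γ bounded (degree< α≡ d<α) (degree< β≡ d<β) (degree< γ≡ d<γ)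
    where degree< : ∀ {ξ} → ↑ (↓ ξ) ≡ ξ → d < degree (↓ ξ) → d < Vec.sum ξ
          degree< {ξ} ↑↓ξ = subst (d <_) (trans (degree-↑ (↓ ξ)) (cong Vec.sum ↑↓ξ))

  data Slice (t : Term n) : Set where
    α-low : degree (↓ (expα t)) ≤ d → Slice t
    β-low : degree (↓ (expβ t)) ≤ d → Slice t
    γ-low : ↓ (expγ t) ∈ E → Slice t
    high  : d < degree (↓ (expα t)) → d < degree (↓ (expβ t)) → d < degree (↓ (expγ t)) → Slice t

  slice : ∀ t → Slice t
  slice t with degree (↓ (expα t)) ≤? d | degree (↓ (expβ t)) ≤? d | degree (↓ (expγ t)) ≤? d
  ... | yes α≤d | _       | _       = α-low α≤d
  ... | no  _   | yes β≤d | _       = β-low β≤d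
  ... | no  _   | no  _   | yes γ≤d = γ-low (∈-E _ γ≤d)
  ... | no  α≰d | no  β≰d | no  γ≰d = high (ℕ.≰⇒> α≰d) (ℕ.≰⇒> β≰d) (ℕ.≰⇒> γ≰d)

  -- The γ-monomial of a γ-low term, as a coordinate vector over the basis E of low-degree exponents.
  γ-coordinate : ∀ {t} → Slice t → Fin (length E) → ℤ
  γ-coordinate (γ-low γ∈E) = δ (Any.index γ∈E)
  γ-coordinate _           = λ _ → 0ℤ

lookup-injective : ∀ {A : Set} {xs : List A} → Unique xs → ∀ i j → lookup xs i ≡ lookup xs j → i ≡ j
lookup-injective {xs = _ ∷ _} _            zero    zero    _  = refl
lookup-injective {xs = _ ∷ _} (x∉xs ∷ _)   zero    (suc j) eq = contradiction eq (All.lookup x∉xs (∈-lookup j))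
lookup-injective {xs = _ ∷ _} (x∉xs ∷ _)   (suc i) zero    eq = contradiction (sym eq) (All.lookup x∉xs (∈-lookup i))
lookup-injective {xs = _ ∷ _} (_ ∷ unique) (suc i) (suc j) eq = cong suc (lookup-injective unique i j eq)

module MatchedFamilies (p : ℕ) .{{_ : NonZero p}} (n : ℕ) where

  record Matched (s : ℕ) : Set where
    field
      A B C        : Fin s → Vec (Fin p) n
      diagonal     : ∀ u → A u ⊕ B u ≡ C u
      off-diagonal : ∀ u v w → A u ⊕ B v ≡ C w → u ≡ w × v ≡ w

  -- Index the family by the distinct targets, each paired with one sequence element attaining it.
  perfectly-matched⇒matched : ∀ {m} (ab : Fin m → Vec (Fin p) n × Vec (Fin p) n) →
                              PerfectlyMatched ab → Matched (targetSize ab)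
  perfectly-matched⇒matched {m} ab perfect = record
    { A = proj₁ ∘ ab ∘ source ; B = proj₂ ∘ ab ∘ source ; C = lookup T
    ; diagonal = λ u → sym (is-source u) ; off-diagonal = off-diagonal }
    where
      target : Fin m → Vec (Fin p) n
      target i = proj₁ (ab i) ⊕ proj₂ (ab i)
      T = deduplicate (Vecₚ.≡-dec _≟ᶠ_) (map target (allFin m))
      has-source : ∀ u → ∃[ i ] lookup T u ≡ target i
      has-source u with ∈-map⁻ target (∈-deduplicate⁻ (Vecₚ.≡-dec _≟ᶠ_) (map target (allFin m)) (∈-lookup u))
      ... | i , _ , Tu≡ti = i , Tu≡ti
      source : Fin (length T) → Fin m
      source u = proj₁ (has-source u)
      is-source : ∀ u → lookup T u ≡ target (source u)
      is-source u = proj₂ (has-source u)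
      distinct : ∀ u v → lookup T u ≡ lookup T v → u ≡ v
      distinct = lookup-injective (deduplicate-! (Vecₚ.≡-dec _≟ᶠ_) (map target (allFin m)))
      off-diagonal : ∀ u v w → proj₁ (ab (source u)) ⊕ proj₂ (ab (source v)) ≡ lookup T w → u ≡ w × v ≡ w
      off-diagonal u v w sum≡Tw = u≡w , trans v≡u u≡w
        where
          same-source : source u ≡ source v
          same-source = perfect (source w) (source u) (source v) (trans (sym (is-source w)) (sym sum≡Tw))
          u≡w = distinct u w (trans (is-source u)
                  (trans (cong (λ i → proj₁ (ab (source u)) ⊕ proj₂ (ab i)) same-source) sum≡Tw))
          v≡u = distinct v u (trans (is-source v) (trans (cong target (sym same-source)) (sym (is-source u))))

module Matching (p : ℕ) .{{_ : NonZero p}} (p-prime : Prime p) (n : ℕ) where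

  open Congruence p
  open PrimeModulus p p-prime
  open Diagonal p p-prime
  open LowDegree p n
  open MatchedFamilies p n public

  module MatchedBound {s} (F : Matched s) where

    open Matched F

    a b c : Fin s → Vec ℤ n
    a u = toℤᵛ (A u)
    b v = toℤᵛ (B v)
    c w = toℤᵛ (C w)

    K : List (Term n)
    K = expansion (p ∸ 1) n

    K-bounded : All (BoundedTerm (p ∸ 1)) K
    K-bounded = expansion-bounded (p ∸ 1) n

    ΦA ΦB : List (Vector ℤ s)
    ΦA = map (λ e u → monomial (a u) (↑ e)) E
    ΦB = map (λ e v → monomial (b v) (↑ e)) E

    open LargeOrthogonal (large-orthogonal ΦA)
      using () renaming (vector to h; orthogonal to h⟂ΦA; large-support to h-large)

    Hα : Term n → ℤ
    Hα t = ∑[ u < s ] (h u *ᶻ monomial (a u) (expα t))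

    Hα≡0 : ∀ t → BoundedTerm (p ∸ 1) t → degree (↓ (expα t)) ≤ d → Hα t ≡0
    Hα≡0 (_ , α , β , γ) bounded α≤d =
      subst (λ ξ → ∑[ u < s ] (h u *ᶻ monomial (a u) ξ) ≡0) (proj₁ (↑↓-bounded α β γ bounded))
        (All.lookup (map⁻ h⟂ΦA) (∈-E (↓ α) α≤d))

    U : Fin (length E) → Vector ℤ s
    U j v = ∑[ t ∈ K ] (γ-coordinate (slice t) j *ᶻ coeff t *ᶻ Hα t *ᶻ monomial (b v) (expβ t))

    open LargeOrthogonal (large-orthogonal (ΦB ++ tabulate U))
      using () renaming (vector to w; orthogonal to w⟂ΦB,U; large-support to w-large)

    Gβ : Term n → ℤ
    Gβ t = ∑[ v < s ] (w v *ᶻ monomial (b v) (expβ t))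

    Gβ≡0 : ∀ t → BoundedTerm (p ∸ 1) t → degree (↓ (expβ t)) ≤ d → Gβ t ≡0
    Gβ≡0 (_ , α , β , γ) bounded β≤d =
      subst (λ ξ → ∑[ v < s ] (w v *ᶻ monomial (b v) ξ) ≡0) (proj₁ (proj₂ (↑↓-bounded α β γ bounded)))
        (All.lookup (map⁻ (++⁻ˡ ΦB w⟂ΦB,U)) (∈-E (↓ β) β≤d))

    w⟂U : ∀ j → w ⟂ U j
    w⟂U j = All.lookup (++⁻ʳ ΦB w⟂ΦB,U) (∈-tabulate⁺ j)

    N : Fin s → Fin s → ℤ
    N v z = ∑[ u < s ] (h u *ᶻ D (A u) (B v) (C z))

    M : Fin s → ℤ
    M z = ∑[ v < s ] (w v *ᶻ N v z)

    N-expanded : ∀ v z →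
      N v z ≡ ∑[ t ∈ K ] (coeff t *ᶻ monomial (b v) (expβ t) *ᶻ monomial (c z) (expγ t) *ᶻ Hα t)
    N-expanded v z = trans
      (sum-cong-≗ (λ u → cong (h u *ᶻ_) (trans (sym (expansion-correct (p ∸ 1) (a u) (b v) (c z)))
        (∑ₗ-cong K (λ t → regroup (coeff t) (monomial (a u) (expα t)) _ _)))))
      (∑-∑ₗ-pull K h (λ t → coeff t *ᶻ monomial (b v) (expβ t) *ᶻ monomial (c z) (expγ t))
                     (λ u t → monomial (a u) (expα t)))
      where regroup : ∀ k x y z → k *ᶻ x *ᶻ y *ᶻ z ≡ k *ᶻ y *ᶻ z *ᶻ x
            regroup = solve-∀

    weight : Term n → ℤ
    weight t = coeff t *ᶻ Hα t *ᶻ Gβ t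

    M-expanded : ∀ z → M z ≡ ∑[ t ∈ K ] (weight t *ᶻ monomial (c z) (expγ t))
    M-expanded z = begin
      ∑[ v < s ] (w v *ᶻ N v z)
        ≡⟨ sum-cong-≗ (λ v → cong (w v *ᶻ_) (trans (N-expanded v z)
             (∑ₗ-cong K (λ t → regroup (coeff t) (monomial (b v) (expβ t)) _ _)))) ⟩
      ∑[ v < s ] (w v *ᶻ ∑[ t ∈ K ] (coeff t *ᶻ Hα t *ᶻ monomial (c z) (expγ t) *ᶻ monomial (b v) (expβ t)))
        ≡⟨ ∑-∑ₗ-pull K w (λ t → coeff t *ᶻ Hα t *ᶻ monomial (c z) (expγ t)) (λ v t → monomial (b v) (expβ t)) ⟩
      ∑[ t ∈ K ] (coeff t *ᶻ Hα t *ᶻ monomial (c z) (expγ t) *ᶻ Gβ t)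
        ≡⟨ ∑ₗ-cong K (λ t → swap-last (coeff t *ᶻ Hα t) (monomial (c z) (expγ t)) (Gβ t)) ⟩
      ∑[ t ∈ K ] (weight t *ᶻ monomial (c z) (expγ t)) ∎
      where
        open ≡-Reasoning
        regroup : ∀ k x y z → k *ᶻ x *ᶻ y *ᶻ z ≡ k *ᶻ z *ᶻ y *ᶻ x
        regroup = solve-∀
        swap-last : ∀ k x y → k *ᶻ x *ᶻ y ≡ k *ᶻ y *ᶻ x
        swap-last = solve-∀

    γ-part : Fin s → (t : Term n) → Slice t → ℤ
    γ-part z t σ = ∑[ j < length E ] (γ-coordinate σ j *ᶻ (weight t *ᶻ monomial (c z) (↑ (lookup E j))))

    γ-part-≡0 : ∀ z t (σ : Slice t) → (∀ j → γ-coordinate σ j ≡ 0ℤ) → γ-part z t σ ≡0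
    γ-part-≡0 z t σ σ≡0 =
      sum-≡0 _ (λ j → subst _≡0 (sym (trans (cong (_*ᶻ X j) (σ≡0 j)) (ℤ.*-zeroˡ (X j)))) 0≡0)
      where X : Fin (length E) → ℤ
            X j = weight t *ᶻ monomial (c z) (↑ (lookup E j))

    γ-part≡term : ∀ z t → BoundedTerm (p ∸ 1) t → (σ : Slice t) →
                  γ-part z t σ ≡ₚ weight t *ᶻ monomial (c z) (expγ t)
    γ-part≡term z t bounded (α-low α≤d) = ∣m∣n⇒∣m-n (γ-part-≡0 z t (α-low α≤d) (λ _ → refl))
      (∣m⇒∣m*n (monomial (c z) (expγ t)) (∣m⇒∣m*n (Gβ t) (∣n⇒∣m*n (coeff t) (Hα≡0 t bounded α≤d))))
    γ-part≡term z t bounded (β-low β≤d) = ∣m∣n⇒∣m-n (γ-part-≡0 z t (β-low β≤d) (λ _ → refl))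
      (∣m⇒∣m*n (monomial (c z) (expγ t)) (∣n⇒∣m*n (coeff t *ᶻ Hα t) (Gβ≡0 t bounded β≤d)))
    γ-part≡term z t@(_ , α , β , γ) bounded (γ-low γ∈E) = ≡⇒≡ₚ (begin
      γ-part z t (γ-low γ∈E)                         ≡⟨ sum-δ (Any.index γ∈E) _ ⟩
      weight t *ᶻ monomial (c z) (↑ (lookup E k))    ≡⟨ cong (λ ξ → weight t *ᶻ monomial (c z) (↑ ξ))
                                                              (lookup-index γ∈E) ⟨
      weight t *ᶻ monomial (c z) (↑ (↓ γ))           ≡⟨ cong (λ ξ → weight t *ᶻ monomial (c z) ξ)
                                                              (proj₂ (proj₂ (↑↓-bounded α β γ bounded))) ⟩
      weight t *ᶻ monomial (c z) γ                   ∎)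
      where
        open ≡-Reasoning
        k = Any.index γ∈E
    γ-part≡term z (_ , α , β , γ) bounded (high d<α d<β d<γ) = ⊥-elim (no-high-term α β γ bounded d<α d<β d<γ)

    ∑γ-part : ∀ z → ∑[ t ∈ K ] γ-part z t (slice t)
                    ≡ ∑[ j < length E ] (monomial (c z) (↑ (lookup E j)) *ᶻ ∑[ v < s ] (w v *ᶻ U j v))
    ∑γ-part z = begin
      ∑[ t ∈ K ] ∑[ j < length E ] (γ-coordinate (slice t) j *ᶻ (weight t *ᶻ g j))
        ≡⟨ ∑-∑ₗ-comm K (λ j t → γ-coordinate (slice t) j *ᶻ (weight t *ᶻ g j)) ⟨
      ∑[ j < length E ] ∑[ t ∈ K ] (γ-coordinate (slice t) j *ᶻ (weight t *ᶻ g j))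
        ≡⟨ sum-cong-≗ (λ j → ∑ₗ-cong K (λ t →
             regroup (γ-coordinate (slice t) j) (coeff t) (Hα t) (Gβ t) (g j))) ⟩
      ∑[ j < length E ] ∑[ t ∈ K ] (g j *ᶻ (γ-coordinate (slice t) j *ᶻ coeff t *ᶻ Hα t *ᶻ Gβ t))
        ≡⟨ sum-cong-≗ (λ j → *-distribˡ-∑ₗ K (g j) _) ⟨
      ∑[ j < length E ] (g j *ᶻ ∑[ t ∈ K ] (γ-coordinate (slice t) j *ᶻ coeff t *ᶻ Hα t *ᶻ Gβ t))
        ≡⟨ sum-cong-≗ (λ j → cong (g j *ᶻ_) (∑-∑ₗ-pull K w (λ t → γ-coordinate (slice t) j *ᶻ coeff t *ᶻ Hα t)
                                                            (λ v t → monomial (b v) (expβ t)))) ⟨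
      ∑[ j < length E ] (g j *ᶻ ∑[ v < s ] (w v *ᶻ U j v)) ∎
      where
        open ≡-Reasoning
        g : Fin (length E) → ℤ
        g j = monomial (c z) (↑ (lookup E j))
        regroup : ∀ γ k x y m → γ *ᶻ (k *ᶻ x *ᶻ y *ᶻ m) ≡ m *ᶻ (γ *ᶻ k *ᶻ x *ᶻ y)
        regroup = solve-∀

    M≡0 : ∀ z → M z ≡0
    M≡0 z = subst _≡0 (sym (M-expanded z))
      (≡ₚ-≡0 (∑ₗ-≡ₚ K (All.map (λ {t} bounded → γ-part≡term z t bounded (slice t)) K-bounded))
        (subst _≡0 (sym (∑γ-part z)) (sum-≡0 _ (λ j → ∣n⇒∣m*n (monomial (c z) (↑ (lookup E j))) (w⟂U j)))))

    κ : Fin s → ℤ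
    κ z = D (A z) (B z) (C z)

    κ≢0 : ∀ z → ¬ κ z ≡0
    κ≢0 z = D-diagonal (A z) (B z) (C z) (diagonal z)

    N-off-diagonal : ∀ v z → v ≢ z → N v z ≡0
    N-off-diagonal v z v≢z = sum-≡0 _ (λ u → ∣n⇒∣m*n (h u)
      (D-off-diagonal (A u) (B v) (C z) (v≢z ∘ proj₂ ∘ off-diagonal u v z)))

    N-diagonal : ∀ z → N z z ≡ₚ h z *ᶻ κ z
    N-diagonal z = sum-≡ₚ-single (λ u → h u *ᶻ D (A u) (B z) (C z)) z (λ u u≢z → ∣n⇒∣m*n (h u)
      (D-off-diagonal (A u) (B z) (C z) (u≢z ∘ proj₁ ∘ off-diagonal u z z)))

    M-diagonal : ∀ z → M z ≡ₚ w z *ᶻ (h z *ᶻ κ z)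
    M-diagonal z = ≡ₚ-trans {M z} {w z *ᶻ N z z} {w z *ᶻ (h z *ᶻ κ z)}
      (sum-≡ₚ-single (λ v → w v *ᶻ N v z) z (λ v v≢z → ∣n⇒∣m*n (w v) (N-off-diagonal v z v≢z)))
      (≡ₚ-*ˡ (w z) (N-diagonal z))

    disjoint-supports : ∀ z → w z ≡0 ⊎ h z ≡0
    disjoint-supports z = Sum.map₂ (λ hκ≡0 → [ (λ h≡0 → h≡0) , (λ κ≡0 → contradiction κ≡0 (κ≢0 z)) ]′
                                               (≡0-*⁻ (h z) (κ z) hκ≡0))
                                   (≡0-*⁻ (w z) (h z *ᶻ κ z) whκ≡0)
      where whκ≡0 : w z *ᶻ (h z *ᶻ κ z) ≡0
            whκ≡0 = ≡ₚ-≡0 {M z} {w z *ᶻ (h z *ᶻ κ z)} (M-diagonal z) (M≡0 z)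

    matched-bound : s ≤ 3 * length E
    matched-bound = three-budget {s} {length E} {support h} {support w}
      (subst (λ k → s ≤ k + support h) (length-map _ E) h-large)
      (subst (λ k → s ≤ k + support w) lengths w-large)
      (support-disjoint w h disjoint-supports)
      where lengths : length (ΦB ++ tabulate U) ≡ length E + length E
            lengths = trans (length-++ ΦB) (cong₂ _+_ (length-map _ E) (length-tabulate U))

theorem1 : (p : ℕ) .{{_ : NonZero p}} → Prime p → (n : ℕ) → 1 ≤ n → (m : ℕ)
    → (ab : Fin m → Vec (Fin p) n × Vec (Fin p) n) → PerfectlyMatched ab
    → targetSize ab ≤ 3 * dimL p n (((p ∸ 1) * n) / 3)
theorem1 p p-prime n _ m ab perfect = MatchedBound.matched-bound (perfectly-matched⇒matched ab perfect)
  where open Matching p p-prime n
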